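{- Let $n$ be even and $F\colon\mathbb F_2^n\to\mathbb F_2^n$ a plateaued APN function. Then $\mathcal N_F\equiv 2\pmod 4$. In particular, if $F$ has at least one balanced component function, then $\mathcal N_F\le 2^{n+1}-6$.
   Context: Scalar product $\langle x,y\rangle=\sum x_iy_i$ on $\mathbb F_2^n$; components $F_b(x)=\langle b,F(x)\rangle$, $b\ne0$; $W_F(b,a)=\sum_x(-1)^{F_b(x)+\langle a,x\rangle}$. A Boolean function $f$ is $t$-plateaued if $|W_f(a)|\in\{0,2^{(n+t)/2}\}$ for all $a$; balanced if it takes value $0$ exactly $2^{n-1}$ times. $F$ is plateaued if each $F_b$, $b\ne0$, is $s_b$-plateaued for some $s_b$. $F$ is APN if for all $a\ne0$ and all $b$ the equation $F(x+a)+F(x)=b$ has at most $2$ solutions. The imbalance is $\mathcal N_F=2^{ -n}\sum_{b\ne0}W_F(b,0)^2$. -}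

module Defs where

open import Data.Bool using (Bool; true; false; _xor_)
open import Data.Nat as ℕ using (ℕ; zero; suc; _≤_; _^_; _∸_)
open import Data.Nat.Properties using (m^n≢0)
open import Data.Integer as ℤ using (ℤ; +_; ∣_∣)
open import Data.Rational as ℚ using (ℚ)
open import Data.Vec using (Vec; []; _∷_; zipWith; replicate; foldr)
open import Data.Vec.Properties using (≡-dec)
open import Data.List as List using (List; length; filter; map; _++_)
open import Data.Product using (Σ; ∃-syntax; _×_)
open import Data.Sum using (_⊎_)
open import Relation.Binary.PropositionalEquality using (_≡_; _≢_)
open import Relation.Nullary.Decidable using (¬?; Dec)
import Data.Bool.Properties as BoolP

-- 𝔽₂ⁿ as Bool-vectors (true = 1, false = 0, addition = xor)
V : ℕ → Set
V n = Vec Bool n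

_⊕_ : ∀ {n} → V n → V n → V n
_⊕_ = zipWith _xor_

𝟎 : ∀ {n} → V n
𝟎 = replicate _ false

⟨_,_⟩ : ∀ {n} → V n → V n → Bool
⟨ [] , [] ⟩ = false
⟨ x ∷ xs , y ∷ ys ⟩ = (x Data.Bool.∧ y) xor ⟨ xs , ys ⟩

allV : (n : ℕ) → List (V n)
allV zero = [] List.∷ List.[]
allV (suc n) = map (false ∷_) (allV n) ++ map (true ∷_) (allV n)

_≟V_ : ∀ {n} (x y : V n) → Dec (x ≡ y)
_≟V_ = ≡-dec BoolP._≟_

sgn : Bool → ℤ
sgn false = + 1
sgn true  = ℤ.- (+ 1)

Σx : (n : ℕ) → (V n → ℤ) → ℤ
Σx n g = List.foldr ℤ._+_ (+ 0) (map g (allV n))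

Walsh : ∀ {n} → (V n → Bool) → V n → ℤ
Walsh {n} f a = Σx n (λ x → sgn (f x xor ⟨ a , x ⟩))

component : ∀ {n} → (V n → V n) → V n → V n → Bool
component F b x = ⟨ b , F x ⟩

WalshF : ∀ {n} → (V n → V n) → V n → V n → ℤ
WalshF F b a = Walsh (component F b) a

IsPlateaued : ∀ {n} → ℕ → (V n → Bool) → Set
IsPlateaued {n} t f = ∀ a → ∣ Walsh f a ∣ ≡ 0 ⊎ ∣ Walsh f a ∣ ≡ 2 ^ ((n ℕ.+ t) ℕ./ 2)

IsBalanced : ∀ {n} → (V n → Bool) → Set
IsBalanced {n} f = length (filter (λ x → f x BoolP.≟ false) (allV n)) ≡ 2 ^ (n ∸ 1)

IsPlateauedF : ∀ {n} → (V n → V n) → Set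
IsPlateauedF F = ∀ b → b ≢ 𝟎 → ∃[ s ] IsPlateaued s (component F b)

IsAPN : ∀ {n} → (V n → V n) → Set
IsAPN {n} F = ∀ a → a ≢ 𝟎 → ∀ b →
  length (filter (λ x → (F (x ⊕ a) ⊕ F x) ≟V b) (allV n)) ≤ 2

sumSqW : ∀ {n} → (V n → V n) → ℤ
sumSqW {n} F = List.foldr ℤ._+_ (+ 0)
  (map (λ b → WalshF F b 𝟎 ℤ.* WalshF F b 𝟎) (filter (λ b → ¬? (b ≟V 𝟎)) (allV n)))

Imbalance : ∀ {n} → (V n → V n) → ℚ
Imbalance {n} F = ℚ._/_ (sumSqW F) (2 ^ n) {{m^n≢0 2 n}}

module Submission where

-- Write p = 2ⁿ and W_b = W_F(b,·).  Fourth moments are sums of squared autocorrelations,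
-- Σ_a W_b(a)⁴ = p Σ_u AC_b(u)², and summing AC_b(u)² over all b counts the pairs (x, y) with
-- F(x+u)+F(x) = F(y+u)+F(y); for APN F there are exactly 2p of them when u ≠ 0, whence
-- Σ_{b≠0} Σ_a W_b(a)⁴ = p³(2p − 2).  If F_b is plateaued then W_b(a)² ∈ {0, 4ʰ}, and Parseval
-- forces 4ʰ ≥ p, so for even n we get 4ʰ = p·4ʳ and Σ_a W_b(a)⁴ = p³·4ʳ.  This exceeds p²·W_b(0)²
-- by 0 if W_b(0) ≠ 0, and by p³·4ʳ with r ≥ 1 if W_b(0) = 0 (r = 0 would make every W_b(a)² equal
-- to p).  Summing over b ≠ 0 gives 𝒩_F + 4J = 2p − 2 with J ≥ 0, and J ≥ 1 when some component
-- is balanced.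

open import Defs
open import Data.Bool using (Bool; true; false; _xor_; _∧_; not; if_then_else_)
import Data.Bool.Properties as Boolₚ
open import Data.Nat using (ℕ; zero; suc; _≤_; _<_; _^_; s≤s; z≤n)
import Data.Nat as ℕ
import Data.Nat.Properties as ℕₚ
open import Data.Nat.Divisibility using (_∣_; divides)
open import Data.Integer using (ℤ; +_; -_; _+_; _*_; _-_)
import Data.Integer as ℤ
import Data.Integer.Properties as ℤₚ
open import Data.Integer.Tactic.RingSolver using (solve-∀)
open import Data.Nat.Tactic.RingSolver using () renaming (solve-∀ to ℕ-solve-∀)
open import Data.Rational using (ℚ; _/_) renaming (_≤_ to _≤ℚ_)
import Data.Rational.Properties as ℚₚ
import Data.Rational.Unnormalised as ℚᵘ
import Data.Rational.Unnormalised.Properties as ℚᵘₚ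
open import Data.List using (List; []; _∷_; _++_; map; filter; length)
open import Data.List.Properties using (length-++; length-map)
open import Data.List.Membership.Propositional using (_∈_)
open import Data.List.Membership.Propositional.Properties using (∈-map⁺; ∈-++⁺ˡ; ∈-++⁺ʳ)
open import Data.List.Relation.Unary.All using (All; []; _∷_)
open import Data.List.Relation.Unary.All.Properties using (all-filter)
open import Data.List.Relation.Unary.Any using (here; there)
open import Data.Vec using ([]; _∷_)
open import Data.Vec.Properties using (∷-injectiveʳ)
open import Data.Vec.Relation.Binary.Pointwise.Inductive using (Pointwise-≡⇒≡; zipWith-comm; zipWith-assoc; zipWith-identityˡ; zipWith-identityʳ)
open import Data.Product using (_×_; _,_; proj₂; ∃-syntax)
open import Data.Sum using (_⊎_; inj₁; inj₂)
open import Data.Empty using (⊥-elim)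
open import Function using (_∘_)
open import Relation.Nullary using (yes; no; does; ¬?)
open import Relation.Unary using (Decidable)
open import Algebra.Bundles using (CommutativeRing)
open import Algebra.Properties.CommutativeSemigroup
  (CommutativeRing.+-commutativeSemigroup Boolₚ.xor-∧-commutativeRing) using () renaming (interchange to xor-interchange)
open import Relation.Binary.PropositionalEquality
  using (_≡_; _≢_; refl; sym; trans; cong; cong₂; subst; subst₂; module ≡-Reasoning)

-- Finite sums

-- Σx n g is ∑ (allV n) g by definition, so the lemmas on ∑ apply to Σx directly.
∑ : {A : Set} → List A → (A → ℤ) → ℤ
∑ l g = Data.List.foldr _+_ (+ 0) (map g l)

module _ {A : Set} where

  ∑-cong : ∀ (l : List A) {f g : A → ℤ} → (∀ x → f x ≡ g x) → ∑ l f ≡ ∑ l g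
  ∑-cong []      f≡g = refl
  ∑-cong (x ∷ l) f≡g = cong₂ _+_ (f≡g x) (∑-cong l f≡g)

  ∑-+ : ∀ (l : List A) (f g : A → ℤ) → ∑ l (λ x → f x + g x) ≡ ∑ l f + ∑ l g
  ∑-+ []      f g = refl
  ∑-+ (x ∷ l) f g = trans (cong (_+_ (f x + g x)) (∑-+ l f g)) (interchange (f x) (g x) (∑ l f) (∑ l g))
    where
    interchange : ∀ a b c d → (a + b) + (c + d) ≡ (a + c) + (b + d)
    interchange = solve-∀

  ∑-*ˡ : ∀ (l : List A) (c : ℤ) (f : A → ℤ) → ∑ l (λ x → c * f x) ≡ c * ∑ l f
  ∑-*ˡ []      c f = sym (ℤₚ.*-zeroʳ c)
  ∑-*ˡ (x ∷ l) c f = trans (cong (_+_ (c * f x)) (∑-*ˡ l c f)) (sym (ℤₚ.*-distribˡ-+ c (f x) (∑ l f)))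

  ∑-*ʳ : ∀ (l : List A) (c : ℤ) (f : A → ℤ) → ∑ l (λ x → f x * c) ≡ ∑ l f * c
  ∑-*ʳ l c f = trans (∑-cong l (λ x → ℤₚ.*-comm (f x) c)) (trans (∑-*ˡ l c f) (ℤₚ.*-comm c (∑ l f)))

  ∑-neg : ∀ (l : List A) (f : A → ℤ) → ∑ l (λ x → - f x) ≡ - ∑ l f
  ∑-neg []      f = refl
  ∑-neg (x ∷ l) f = trans (cong (_+_ (- f x)) (∑-neg l f)) (sym (ℤₚ.neg-distrib-+ (f x) (∑ l f)))

  ∑-- : ∀ (l : List A) (f g : A → ℤ) → ∑ l (λ x → f x - g x) ≡ ∑ l f - ∑ l g
  ∑-- l f g = trans (∑-+ l f (λ x → - g x)) (cong (_+_ (∑ l f)) (∑-neg l g))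

  ∑-const : ∀ (l : List A) (c : ℤ) → ∑ l (λ _ → c) ≡ + length l * c
  ∑-const []      c = sym (ℤₚ.*-zeroˡ c)
  ∑-const (x ∷ l) c = trans (cong (_+_ c) (∑-const l c)) (sym (ℤₚ.suc-* (+ length l) c))

  ∑-++ : ∀ (l m : List A) (f : A → ℤ) → ∑ (l ++ m) f ≡ ∑ l f + ∑ m f
  ∑-++ []      m f = sym (ℤₚ.+-identityˡ (∑ m f))
  ∑-++ (x ∷ l) m f = trans (cong (_+_ (f x)) (∑-++ l m f)) (sym (ℤₚ.+-assoc (f x) (∑ l f) (∑ m f)))

  ∑-map : ∀ {B : Set} (h : B → A) (l : List B) (f : A → ℤ) → ∑ (map h l) f ≡ ∑ l (f ∘ h)
  ∑-map h []      f = refl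
  ∑-map h (x ∷ l) f = cong (_+_ (f (h x))) (∑-map h l f)

  ∑-filter : ∀ {P : A → Set} (P? : Decidable P) (l : List A) (f : A → ℤ) →
             ∑ (filter P? l) f ≡ ∑ l (λ x → if does (P? x) then f x else + 0)
  ∑-filter P? []      f = refl
  ∑-filter P? (x ∷ l) f with does (P? x)
  ... | true  = cong (_+_ (f x)) (∑-filter P? l f)
  ... | false = trans (∑-filter P? l f) (sym (ℤₚ.+-identityˡ _))

  ∑-mono-≤ : ∀ (l : List A) {f g : A → ℤ} → (∀ x → f x ℤ.≤ g x) → ∑ l f ℤ.≤ ∑ l g
  ∑-mono-≤ []      f≤g = ℤₚ.≤-refl
  ∑-mono-≤ (x ∷ l) f≤g = ℤₚ.+-mono-≤ (f≤g x) (∑-mono-≤ l f≤g)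

  ∑-mono-< : ∀ {l : List A} {f g : A → ℤ} {y} → (∀ x → f x ℤ.≤ g x) → y ∈ l → f y ℤ.< g y →
             ∑ l f ℤ.< ∑ l g
  ∑-mono-< {x ∷ l} f≤g (here refl) fy<gy = ℤₚ.+-mono-<-≤ fy<gy (∑-mono-≤ l f≤g)
  ∑-mono-< {x ∷ l} f≤g (there y∈l) fy<gy = ℤₚ.+-mono-≤-< (f≤g x) (∑-mono-< f≤g y∈l fy<gy)

∑-swap : ∀ {A B : Set} (l : List A) (m : List B) (g : A → B → ℤ) →
         ∑ l (λ x → ∑ m (g x)) ≡ ∑ m (λ y → ∑ l (λ x → g x y))
∑-swap []      m g = sym (trans (∑-const m (+ 0)) (ℤₚ.*-zeroʳ (+ length m)))
∑-swap (x ∷ l) m g = trans (cong (_+_ (∑ m (g x))) (∑-swap l m g)) (sym (∑-+ m (g x) (λ y → ∑ l (λ x → g x y))))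

∑-*-∑ : ∀ {A B : Set} (l : List A) (m : List B) (f : A → ℤ) (g : B → ℤ) →
        ∑ l f * ∑ m g ≡ ∑ l (λ x → ∑ m (λ y → f x * g y))
∑-*-∑ l m f g = trans (sym (∑-*ʳ l (∑ m g) f)) (∑-cong l (λ x → sym (∑-*ˡ m (f x) g)))

-- The space 𝔽₂ⁿ and its characters

⊕-comm : ∀ {n} (x y : V n) → x ⊕ y ≡ y ⊕ x
⊕-comm x y = Pointwise-≡⇒≡ (zipWith-comm Boolₚ.xor-comm x y)

⊕-assoc : ∀ {n} (x y z : V n) → (x ⊕ y) ⊕ z ≡ x ⊕ (y ⊕ z)
⊕-assoc x y z = Pointwise-≡⇒≡ (zipWith-assoc Boolₚ.xor-assoc x y z)

⊕-identityˡ : ∀ {n} (x : V n) → 𝟎 ⊕ x ≡ x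
⊕-identityˡ x = Pointwise-≡⇒≡ (zipWith-identityˡ Boolₚ.xor-identityˡ x)

⊕-identityʳ : ∀ {n} (x : V n) → x ⊕ 𝟎 ≡ x
⊕-identityʳ x = Pointwise-≡⇒≡ (zipWith-identityʳ Boolₚ.xor-identityʳ x)

⊕-self : ∀ {n} (x : V n) → x ⊕ x ≡ 𝟎
⊕-self []      = refl
⊕-self (b ∷ x) = cong₂ _∷_ (Boolₚ.xor-same b) (⊕-self x)

⊕-cancelʳ : ∀ {n} (x y : V n) → (x ⊕ y) ⊕ y ≡ x
⊕-cancelʳ x y = trans (⊕-assoc x y y) (trans (cong (x ⊕_) (⊕-self y)) (⊕-identityʳ x))

⊕-cancelˡ : ∀ {n} (x y : V n) → x ⊕ (x ⊕ y) ≡ y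
⊕-cancelˡ x y = trans (sym (⊕-assoc x x y)) (trans (cong (_⊕ y) (⊕-self x)) (⊕-identityˡ y))

⊕≡𝟎⇒≡ : ∀ {n} (x y : V n) → x ⊕ y ≡ 𝟎 → x ≡ y
⊕≡𝟎⇒≡ x y x⊕y≡𝟎 = trans (sym (⊕-cancelʳ x y)) (trans (cong (_⊕ y) x⊕y≡𝟎) (⊕-identityˡ y))

⟨𝟎,_⟩ : ∀ {n} (x : V n) → ⟨ 𝟎 , x ⟩ ≡ false
⟨𝟎, []    ⟩ = refl
⟨𝟎, b ∷ x ⟩ = ⟨𝟎, x ⟩

⟨_,𝟎⟩ : ∀ {n} (a : V n) → ⟨ a , 𝟎 ⟩ ≡ false
⟨ []    ,𝟎⟩ = refl
⟨ b ∷ a ,𝟎⟩ = cong₂ _xor_ (Boolₚ.∧-zeroʳ b) ⟨ a ,𝟎⟩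

⟨⟩-⊕ : ∀ {n} (a x y : V n) → ⟨ a , x ⊕ y ⟩ ≡ ⟨ a , x ⟩ xor ⟨ a , y ⟩
⟨⟩-⊕ []      []      []      = refl
⟨⟩-⊕ (α ∷ a) (ξ ∷ x) (η ∷ y) =
  trans (cong₂ _xor_ (Boolₚ.∧-distribˡ-xor α ξ η) (⟨⟩-⊕ a x y)) (xor-interchange (α ∧ ξ) (α ∧ η) ⟨ a , x ⟩ ⟨ a , y ⟩)

length-allV : ∀ n → length (allV n) ≡ 2 ^ n
length-allV zero    = refl
length-allV (suc n) = begin
  length (map (false ∷_) (allV n) ++ map (true ∷_) (allV n))
    ≡⟨ length-++ (map (false ∷_) (allV n)) ⟩
  length (map (false ∷_) (allV n)) ℕ.+ length (map (true ∷_) (allV n))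
    ≡⟨ cong₂ ℕ._+_ (length-map (false ∷_) (allV n)) (length-map (true ∷_) (allV n)) ⟩
  length (allV n) ℕ.+ length (allV n)
    ≡⟨ cong (λ m → m ℕ.+ m) (length-allV n) ⟩
  2 ^ n ℕ.+ 2 ^ n
    ≡⟨ cong (2 ^ n ℕ.+_) (sym (ℕₚ.+-identityʳ (2 ^ n))) ⟩
  2 ^ suc n ∎
  where open ≡-Reasoning

∈-allV : ∀ {n} (x : V n) → x ∈ allV n
∈-allV []          = here refl
∈-allV (false ∷ x) = ∈-++⁺ˡ (∈-map⁺ (false ∷_) (∈-allV x))
∈-allV (true ∷ x)  = ∈-++⁺ʳ (map (false ∷_) (allV _)) (∈-map⁺ (true ∷_) (∈-allV x))

Σx-split : ∀ n (g : V (suc n) → ℤ) → Σx (suc n) g ≡ Σx n (λ x → g (false ∷ x)) + Σx n (λ x → g (true ∷ x))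
Σx-split n g = trans (∑-++ (map (false ∷_) (allV n)) (map (true ∷_) (allV n)) g)
                     (cong₂ _+_ (∑-map (false ∷_) (allV n) g) (∑-map (true ∷_) (allV n) g))

Σx-const : ∀ n (c : ℤ) → Σx n (λ _ → c) ≡ + (2 ^ n) * c
Σx-const n c = trans (∑-const (allV n) c) (cong (λ m → + m * c) (length-allV n))

Σx-zero : ∀ n (g : V n → ℤ) → (∀ x → g x ≡ + 0) → Σx n g ≡ + 0
Σx-zero n g g≡0 = trans (∑-cong (allV n) g≡0) (trans (Σx-const n (+ 0)) (ℤₚ.*-zeroʳ (+ (2 ^ n))))

Σx-single : ∀ n (g : V n → ℤ) (a : V n) → (∀ x → x ≢ a → g x ≡ + 0) → Σx n g ≡ g a
Σx-single zero    g []          _ = ℤₚ.+-identityʳ (g [])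
Σx-single (suc n) g (false ∷ a) g≡0 = begin
  Σx (suc n) g
    ≡⟨ Σx-split n g ⟩
  Σx n (λ x → g (false ∷ x)) + Σx n (λ x → g (true ∷ x))
    ≡⟨ cong₂ _+_ (Σx-single n (λ x → g (false ∷ x)) a (λ x x≢a → g≡0 (false ∷ x) (x≢a ∘ ∷-injectiveʳ)))
                 (Σx-zero n (λ x → g (true ∷ x)) (λ x → g≡0 (true ∷ x) λ ())) ⟩
  g (false ∷ a) + + 0
    ≡⟨ ℤₚ.+-identityʳ _ ⟩
  g (false ∷ a) ∎
  where open ≡-Reasoning
Σx-single (suc n) g (true ∷ a) g≡0 = begin
  Σx (suc n) g
    ≡⟨ Σx-split n g ⟩
  Σx n (λ x → g (false ∷ x)) + Σx n (λ x → g (true ∷ x))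
    ≡⟨ cong₂ _+_ (Σx-zero n (λ x → g (false ∷ x)) (λ x → g≡0 (false ∷ x) λ ()))
                 (Σx-single n (λ x → g (true ∷ x)) a (λ x x≢a → g≡0 (true ∷ x) (x≢a ∘ ∷-injectiveʳ))) ⟩
  + 0 + g (true ∷ a)
    ≡⟨ ℤₚ.+-identityˡ _ ⟩
  g (true ∷ a) ∎
  where open ≡-Reasoning

Σx-translate : ∀ n (g : V n → ℤ) (a : V n) → Σx n (λ x → g (x ⊕ a)) ≡ Σx n g
Σx-translate zero    g []          = refl
Σx-translate (suc n) g (false ∷ a) = begin
  Σx (suc n) (λ x → g (x ⊕ (false ∷ a)))
    ≡⟨ Σx-split n _ ⟩
  Σx n (λ x → g (false ∷ (x ⊕ a))) + Σx n (λ x → g (true ∷ (x ⊕ a)))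
    ≡⟨ cong₂ _+_ (Σx-translate n (λ x → g (false ∷ x)) a) (Σx-translate n (λ x → g (true ∷ x)) a) ⟩
  Σx n (λ x → g (false ∷ x)) + Σx n (λ x → g (true ∷ x))
    ≡⟨ Σx-split n g ⟨
  Σx (suc n) g ∎
  where open ≡-Reasoning
Σx-translate (suc n) g (true ∷ a) = begin
  Σx (suc n) (λ x → g (x ⊕ (true ∷ a)))
    ≡⟨ Σx-split n _ ⟩
  Σx n (λ x → g (true ∷ (x ⊕ a))) + Σx n (λ x → g (false ∷ (x ⊕ a)))
    ≡⟨ cong₂ _+_ (Σx-translate n (λ x → g (true ∷ x)) a) (Σx-translate n (λ x → g (false ∷ x)) a) ⟩
  Σx n (λ x → g (true ∷ x)) + Σx n (λ x → g (false ∷ x))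
    ≡⟨ ℤₚ.+-comm (Σx n (λ x → g (true ∷ x))) _ ⟩
  Σx n (λ x → g (false ∷ x)) + Σx n (λ x → g (true ∷ x))
    ≡⟨ Σx-split n g ⟨
  Σx (suc n) g ∎
  where open ≡-Reasoning

δ : ∀ {n} → V n → V n → ℤ
δ x y = if does (x ≟V y) then + 1 else + 0

δ-refl : ∀ {n} (x : V n) → δ x x ≡ + 1
δ-refl x with x ≟V x
... | yes _   = refl
... | no x≢x = ⊥-elim (x≢x refl)

δ-≢ : ∀ {n} {x y : V n} → x ≢ y → δ x y ≡ + 0
δ-≢ {x = x} {y} x≢y with x ≟V y
... | yes x≡y = ⊥-elim (x≢y x≡y)
... | no _    = refl

0≤δ : ∀ {n} (x y : V n) → + 0 ℤ.≤ δ x y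
0≤δ x y with x ≟V y
... | yes _ = ℤ.+≤+ z≤n
... | no _  = ℤ.+≤+ z≤n

Σx-δ : ∀ n (h : V n → ℤ) (x : V n) → Σx n (λ y → h y * δ y x) ≡ h x
Σx-δ n h x = trans (Σx-single n _ x (λ y y≢x → trans (cong (h y *_) (δ-≢ y≢x)) (ℤₚ.*-zeroʳ (h y))))
                   (trans (cong (h x *_) (δ-refl x)) (ℤₚ.*-identityʳ (h x)))

Σx-δ-const : ∀ n (x : V n) → Σx n (λ y → δ y x) ≡ + 1
Σx-δ-const n x = trans (∑-cong (allV n) (λ y → sym (ℤₚ.*-identityˡ (δ y x)))) (Σx-δ n (λ _ → + 1) x)

Σx-δ-count : ∀ n (h : V n → V n) (β : V n) → Σx n (λ y → δ (h y) β) ≡ + length (filter (λ y → h y ≟V β) (allV n))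
Σx-δ-count n h β = trans (sym (∑-filter (λ y → h y ≟V β) (allV n) (λ _ → + 1)))
                         (trans (∑-const (filter (λ y → h y ≟V β) (allV n)) (+ 1)) (ℤₚ.*-identityʳ _))

Σx-constant-off-𝟎 : ∀ n (g : V n → ℤ) (c : ℤ) → (∀ u → u ≢ 𝟎 → g u ≡ c) → Σx n g ≡ (g 𝟎 - c) + + (2 ^ n) * c
Σx-constant-off-𝟎 n g c g≡c = begin
  Σx n g                               ≡⟨ ∑-cong (allV n) (λ u → split (g u) c) ⟩
  Σx n (λ u → (g u - c) + c)           ≡⟨ ∑-+ (allV n) (λ u → g u - c) (λ _ → c) ⟩
  Σx n (λ u → g u - c) + Σx n (λ _ → c) ≡⟨ cong₂ _+_ (Σx-single n _ 𝟎 (λ u u≢𝟎 → trans (cong (_- c) (g≡c u u≢𝟎)) (ℤₚ.+-inverseʳ c)))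
                                                     (Σx-const n c) ⟩
  (g 𝟎 - c) + + (2 ^ n) * c ∎
  where
  open ≡-Reasoning
  split : ∀ x c → x ≡ (x - c) + c
  split = solve-∀

nonzero : ∀ n → List (V n)
nonzero n = filter (λ b → ¬? (b ≟V 𝟎)) (allV n)

∑-nonzero : ∀ n (g : V n → ℤ) → ∑ (nonzero n) g ≡ Σx n g - g 𝟎
∑-nonzero n g = begin
  ∑ (nonzero n) g
    ≡⟨ ∑-filter (λ b → ¬? (b ≟V 𝟎)) (allV n) g ⟩
  Σx n (λ b → if does (¬? (b ≟V 𝟎)) then g b else + 0)
    ≡⟨ ∑-cong (allV n) drop-𝟎 ⟩
  Σx n (λ b → g b - g b * δ b 𝟎)
    ≡⟨ ∑-- (allV n) g (λ b → g b * δ b 𝟎) ⟩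
  Σx n g - Σx n (λ b → g b * δ b 𝟎)
    ≡⟨ cong (_-_ (Σx n g)) (Σx-δ n g 𝟎) ⟩
  Σx n g - g 𝟎 ∎
  where
  open ≡-Reasoning
  drop-𝟎 : ∀ b → (if does (¬? (b ≟V 𝟎)) then g b else + 0) ≡ g b - g b * δ b 𝟎
  drop-𝟎 b with b ≟V 𝟎
  ... | yes _ = sym (trans (cong (_-_ (g b)) (ℤₚ.*-identityʳ (g b))) (ℤₚ.+-inverseʳ (g b)))
  ... | no _  = sym (trans (cong (_-_ (g b)) (ℤₚ.*-zeroʳ (g b))) (ℤₚ.+-identityʳ (g b)))

χ : ∀ {n} → V n → V n → ℤ
χ a x = sgn ⟨ a , x ⟩

sgn-xor : ∀ p q → sgn (p xor q) ≡ sgn p * sgn q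
sgn-xor false q     = sym (ℤₚ.*-identityˡ (sgn q))
sgn-xor true  false = refl
sgn-xor true  true  = refl

sgn² : ∀ p → sgn p * sgn p ≡ + 1
sgn² false = refl
sgn² true  = refl

χ-⊕ : ∀ {n} (a x y : V n) → χ a x * χ a y ≡ χ a (x ⊕ y)
χ-⊕ a x y = trans (sym (sgn-xor ⟨ a , x ⟩ ⟨ a , y ⟩)) (cong sgn (sym (⟨⟩-⊕ a x y)))

Σx-χ-𝟎 : ∀ n → Σx n (λ a → χ a 𝟎) ≡ + (2 ^ n)
Σx-χ-𝟎 n = trans (∑-cong (allV n) (λ a → cong sgn ⟨ a ,𝟎⟩)) (trans (Σx-const n (+ 1)) (ℤₚ.*-identityʳ _))

Σx-χ-≢𝟎 : ∀ n (x : V n) → x ≢ 𝟎 → Σx n (λ a → χ a x) ≡ + 0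
Σx-χ-≢𝟎 zero    []          x≢𝟎 = ⊥-elim (x≢𝟎 refl)
Σx-χ-≢𝟎 (suc n) (false ∷ x) x≢𝟎 = begin
  Σx (suc n) (λ a → χ a (false ∷ x))
    ≡⟨ Σx-split n _ ⟩
  Σx n (λ a → χ a x) + Σx n (λ a → χ a x)
    ≡⟨ cong₂ _+_ ih ih ⟩
  + 0 ∎
  where
  open ≡-Reasoning
  ih = Σx-χ-≢𝟎 n x (x≢𝟎 ∘ cong (false ∷_))
Σx-χ-≢𝟎 (suc n) (true ∷ x) _ = begin
  Σx (suc n) (λ a → χ a (true ∷ x))
    ≡⟨ Σx-split n _ ⟩
  Σx n (λ a → χ a x) + Σx n (λ a → sgn (not ⟨ a , x ⟩))
    ≡⟨ cong (_+_ (Σx n (λ a → χ a x))) (trans (∑-cong (allV n) (λ a → sgn-not ⟨ a , x ⟩)) (∑-neg (allV n) _)) ⟩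
  Σx n (λ a → χ a x) - Σx n (λ a → χ a x)
    ≡⟨ ℤₚ.+-inverseʳ (Σx n (λ a → χ a x)) ⟩
  + 0 ∎
  where
  open ≡-Reasoning
  sgn-not : ∀ p → sgn (not p) ≡ - sgn p
  sgn-not false = refl
  sgn-not true  = refl

Σx-χ-⊕ : ∀ n (x y : V n) → Σx n (λ a → χ a (x ⊕ y)) ≡ + (2 ^ n) * δ y x
Σx-χ-⊕ n x y with y ≟V x
... | yes refl = trans (∑-cong (allV n) (λ a → cong (χ a) (⊕-self y))) (trans (Σx-χ-𝟎 n) (sym (ℤₚ.*-identityʳ _)))
... | no y≢x  = trans (Σx-χ-≢𝟎 n (x ⊕ y) (y≢x ∘ sym ∘ ⊕≡𝟎⇒≡ x y)) (sym (ℤₚ.*-zeroʳ (+ (2 ^ n))))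

-- Fourier transform, Walsh transform and autocorrelation

FT : ∀ {n} → (V n → ℤ) → V n → ℤ
FT {n} g a = Σx n (λ x → g x * χ a x)

FT-squared : ∀ n (g : V n → ℤ) (a : V n) →
             FT g a * FT g a ≡ Σx n (λ x → Σx n (λ y → (g x * g y) * χ a (x ⊕ y)))
FT-squared n g a = trans (∑-*-∑ (allV n) (allV n) (λ x → g x * χ a x) (λ y → g y * χ a y))
  (∑-cong (allV n) λ x → ∑-cong (allV n) λ y →
    trans (interchange (g x) (χ a x) (g y) (χ a y)) (cong ((g x * g y) *_) (χ-⊕ a x y)))
  where
  interchange : ∀ p q r s → (p * q) * (r * s) ≡ (p * r) * (q * s)
  interchange = solve-∀

plancherel : ∀ n (g : V n → ℤ) → Σx n (λ a → FT g a * FT g a) ≡ + (2 ^ n) * Σx n (λ x → g x * g x)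
plancherel n g = begin
  Σx n (λ a → FT g a * FT g a)
    ≡⟨ ∑-cong (allV n) (FT-squared n g) ⟩
  Σx n (λ a → Σx n (λ x → Σx n (λ y → (g x * g y) * χ a (x ⊕ y))))
    ≡⟨ ∑-swap (allV n) (allV n) _ ⟩
  Σx n (λ x → Σx n (λ a → Σx n (λ y → (g x * g y) * χ a (x ⊕ y))))
    ≡⟨ ∑-cong (allV n) (λ x → ∑-swap (allV n) (allV n) _) ⟩
  Σx n (λ x → Σx n (λ y → Σx n (λ a → (g x * g y) * χ a (x ⊕ y))))
    ≡⟨ ∑-cong (allV n) (λ x → ∑-cong (allV n) λ y →
         trans (∑-*ˡ (allV n) (g x * g y) (λ a → χ a (x ⊕ y))) (cong ((g x * g y) *_) (Σx-χ-⊕ n x y))) ⟩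
  Σx n (λ x → Σx n (λ y → (g x * g y) * (+ (2 ^ n) * δ y x)))
    ≡⟨ ∑-cong (allV n) (λ x → trans (∑-cong (allV n) λ y → sym (ℤₚ.*-assoc (g x * g y) _ (δ y x)))
                                    (Σx-δ n (λ y → (g x * g y) * + (2 ^ n)) x)) ⟩
  Σx n (λ x → (g x * g x) * + (2 ^ n))
    ≡⟨ ∑-*ʳ (allV n) (+ (2 ^ n)) (λ x → g x * g x) ⟩
  Σx n (λ x → g x * g x) * + (2 ^ n)
    ≡⟨ ℤₚ.*-comm _ (+ (2 ^ n)) ⟩
  + (2 ^ n) * Σx n (λ x → g x * g x) ∎
  where open ≡-Reasoning

AC : ∀ {n} → (V n → Bool) → V n → ℤ
AC {n} f u = Σx n (λ x → sgn (f x) * sgn (f (x ⊕ u)))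

module _ {n : ℕ} (f : V n → Bool) where

  Walsh≡FT : ∀ a → Walsh f a ≡ FT (sgn ∘ f) a
  Walsh≡FT a = ∑-cong (allV n) (λ x → sgn-xor (f x) ⟨ a , x ⟩)

  parseval : Σx n (λ a → Walsh f a * Walsh f a) ≡ + (2 ^ n) * + (2 ^ n)
  parseval = begin
    Σx n (λ a → Walsh f a * Walsh f a)
      ≡⟨ ∑-cong (allV n) (λ a → cong₂ _*_ (Walsh≡FT a) (Walsh≡FT a)) ⟩
    Σx n (λ a → FT (sgn ∘ f) a * FT (sgn ∘ f) a)
      ≡⟨ plancherel n (sgn ∘ f) ⟩
    + (2 ^ n) * Σx n (λ x → sgn (f x) * sgn (f x))
      ≡⟨ cong (+ (2 ^ n) *_) (trans (∑-cong (allV n) (λ x → sgn² (f x))) (trans (Σx-const n (+ 1)) (ℤₚ.*-identityʳ _))) ⟩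
    + (2 ^ n) * + (2 ^ n) ∎
    where open ≡-Reasoning

  Walsh²≡FT-AC : ∀ a → Walsh f a * Walsh f a ≡ FT (AC f) a
  Walsh²≡FT-AC a = begin
    Walsh f a * Walsh f a
      ≡⟨ cong₂ _*_ (Walsh≡FT a) (Walsh≡FT a) ⟩
    FT s a * FT s a
      ≡⟨ FT-squared n s a ⟩
    Σx n (λ x → Σx n (λ y → (s x * s y) * χ a (x ⊕ y)))
      ≡⟨ ∑-cong (allV n) (λ x → sym (Σx-translate n (λ y → (s x * s y) * χ a (x ⊕ y)) x)) ⟩
    Σx n (λ x → Σx n (λ u → (s x * s (u ⊕ x)) * χ a (x ⊕ (u ⊕ x))))
      ≡⟨ ∑-cong (allV n) (λ x → ∑-cong (allV n) λ u →
           trans (cong (λ y → (s x * s y) * χ a (x ⊕ y)) (⊕-comm u x))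
                 (cong (λ v → (s x * s (x ⊕ u)) * χ a v) (⊕-cancelˡ x u))) ⟩
    Σx n (λ x → Σx n (λ u → (s x * s (x ⊕ u)) * χ a u))
      ≡⟨ ∑-swap (allV n) (allV n) _ ⟩
    Σx n (λ u → Σx n (λ x → (s x * s (x ⊕ u)) * χ a u))
      ≡⟨ ∑-cong (allV n) (λ u → ∑-*ʳ (allV n) (χ a u) (λ x → s x * s (x ⊕ u))) ⟩
    FT (AC f) a ∎
    where
    open ≡-Reasoning
    s = sgn ∘ f

fourthMoment : ∀ {n} → (V n → Bool) → ℤ
fourthMoment {n} f = Σx n (λ a → (Walsh f a * Walsh f a) * (Walsh f a * Walsh f a))

fourthMoment≡Σx-AC² : ∀ {n} (f : V n → Bool) → fourthMoment f ≡ + (2 ^ n) * Σx n (λ u → AC f u * AC f u)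
fourthMoment≡Σx-AC² {n} f = trans (∑-cong (allV n) (λ a → cong₂ _*_ (Walsh²≡FT-AC f a) (Walsh²≡FT-AC f a))) (plancherel n (AC f))

AC-𝟎 : ∀ {n} (f : V n → Bool) → AC f 𝟎 ≡ + (2 ^ n)
AC-𝟎 {n} f = trans (∑-cong (allV n) (λ x → trans (cong (λ y → sgn (f x) * sgn (f y)) (⊕-identityʳ x)) (sgn² (f x))))
                   (trans (Σx-const n (+ 1)) (ℤₚ.*-identityʳ _))

-- Fourth moments of an APN function

module _ {n : ℕ} (F : V n → V n) where

  private
    p : ℤ
    p = + (2 ^ n)

  derivative : V n → V n → V n
  derivative u x = F (x ⊕ u) ⊕ F x

  solutionCount : V n → V n → ℤ
  solutionCount u x = Σx n (λ y → δ (derivative u y) (derivative u x))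

  derivative-⊕ : ∀ u x → derivative u (x ⊕ u) ≡ derivative u x
  derivative-⊕ u x = trans (cong (λ v → F v ⊕ F (x ⊕ u)) (⊕-cancelʳ x u)) (⊕-comm (F x) (F (x ⊕ u)))

  AC-component : ∀ b u → AC (component F b) u ≡ Σx n (λ x → χ b (derivative u x))
  AC-component b u = ∑-cong (allV n) λ x →
    trans (χ-⊕ b (F x) (F (x ⊕ u))) (cong (χ b) (⊕-comm (F x) (F (x ⊕ u))))

  Σx-AC²-components : ∀ u → Σx n (λ b → AC (component F b) u * AC (component F b) u) ≡ p * Σx n (solutionCount u)
  Σx-AC²-components u = begin
    Σx n (λ b → AC (component F b) u * AC (component F b) u)
      ≡⟨ ∑-cong (allV n) (λ b → trans (cong₂ _*_ (AC-component b u) (AC-component b u))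
                                      (∑-*-∑ (allV n) (allV n) (λ x → χ b (D x)) (λ y → χ b (D y)))) ⟩
    Σx n (λ b → Σx n (λ x → Σx n (λ y → χ b (D x) * χ b (D y))))
      ≡⟨ ∑-swap (allV n) (allV n) _ ⟩
    Σx n (λ x → Σx n (λ b → Σx n (λ y → χ b (D x) * χ b (D y))))
      ≡⟨ ∑-cong (allV n) (λ x → ∑-swap (allV n) (allV n) _) ⟩
    Σx n (λ x → Σx n (λ y → Σx n (λ b → χ b (D x) * χ b (D y))))
      ≡⟨ ∑-cong (allV n) (λ x → ∑-cong (allV n) λ y →
           trans (∑-cong (allV n) (λ b → χ-⊕ b (D x) (D y))) (Σx-χ-⊕ n (D x) (D y))) ⟩
    Σx n (λ x → Σx n (λ y → p * δ (D y) (D x)))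
      ≡⟨ ∑-cong (allV n) (λ x → ∑-*ˡ (allV n) p (λ y → δ (D y) (D x))) ⟩
    Σx n (λ x → p * solutionCount u x)
      ≡⟨ ∑-*ˡ (allV n) p (solutionCount u) ⟩
    p * Σx n (solutionCount u) ∎
    where
    open ≡-Reasoning
    D = derivative u

  -- y = x and y = x ⊕ u are two distinct solutions of D_u F(y) = D_u F(x).
  δ+δ≤δ-derivative : ∀ u x y → u ≢ 𝟎 → δ y x + δ y (x ⊕ u) ℤ.≤ δ (derivative u y) (derivative u x)
  δ+δ≤δ-derivative u x y u≢𝟎 with y ≟V x | y ≟V (x ⊕ u)
  ... | yes refl | yes y≡y⊕u = ⊥-elim (u≢𝟎 (trans (sym (⊕-cancelˡ y u)) (trans (cong (y ⊕_) (sym y≡y⊕u)) (⊕-self y))))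
  ... | yes refl | no _      = ℤₚ.≤-reflexive (sym (δ-refl (derivative u y)))
  ... | no _     | yes refl  =
    ℤₚ.≤-reflexive (sym (trans (cong (λ v → δ v (derivative u x)) (derivative-⊕ u x)) (δ-refl (derivative u x))))
  ... | no _     | no _      = 0≤δ (derivative u y) (derivative u x)

  solutionCount-APN : IsAPN F → ∀ u x → u ≢ 𝟎 → solutionCount u x ≡ + 2
  solutionCount-APN apn u x u≢𝟎 = ℤₚ.≤-antisym upper lower
    where
    upper : solutionCount u x ℤ.≤ + 2
    upper = subst (ℤ._≤ + 2) (sym (Σx-δ-count n (derivative u) (derivative u x))) (ℤ.+≤+ (apn u u≢𝟎 (derivative u x)))
    lower : + 2 ℤ.≤ solutionCount u x
    lower = subst (ℤ._≤ solutionCount u x)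
                  (trans (∑-+ (allV n) (λ y → δ y x) (λ y → δ y (x ⊕ u))) (cong₂ _+_ (Σx-δ-const n x) (Σx-δ-const n (x ⊕ u))))
                  (∑-mono-≤ (allV n) (λ y → δ+δ≤δ-derivative u x y u≢𝟎))

  Σx-fourthMoment-components : IsAPN F →
    Σx n (λ b → fourthMoment (component F b)) ≡ p * ((p * (p * p) - p * (p * + 2)) + p * (p * (p * + 2)))
  Σx-fourthMoment-components apn = begin
    Σx n (λ b → fourthMoment (component F b))
      ≡⟨ ∑-cong (allV n) (λ b → fourthMoment≡Σx-AC² (component F b)) ⟩
    Σx n (λ b → p * Σx n (λ u → AC (component F b) u * AC (component F b) u))
      ≡⟨ ∑-*ˡ (allV n) p _ ⟩
    p * Σx n (λ b → Σx n (λ u → AC (component F b) u * AC (component F b) u))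
      ≡⟨ cong (p *_) (∑-swap (allV n) (allV n) _) ⟩
    p * Σx n (λ u → Σx n (λ b → AC (component F b) u * AC (component F b) u))
      ≡⟨ cong (p *_) (Σx-constant-off-𝟎 n _ (p * (p * + 2)) off-𝟎) ⟩
    p * ((Σx n (λ b → AC (component F b) 𝟎 * AC (component F b) 𝟎) - p * (p * + 2)) + p * (p * (p * + 2)))
      ≡⟨ cong (λ z → p * ((z - p * (p * + 2)) + p * (p * (p * + 2)))) at-𝟎 ⟩
    p * ((p * (p * p) - p * (p * + 2)) + p * (p * (p * + 2))) ∎
    where
    open ≡-Reasoning
    at-𝟎 : Σx n (λ b → AC (component F b) 𝟎 * AC (component F b) 𝟎) ≡ p * (p * p)
    at-𝟎 = trans (∑-cong (allV n) (λ b → cong₂ _*_ (AC-𝟎 (component F b)) (AC-𝟎 (component F b)))) (Σx-const n (p * p))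
    off-𝟎 : ∀ u → u ≢ 𝟎 → Σx n (λ b → AC (component F b) u * AC (component F b) u) ≡ p * (p * + 2)
    off-𝟎 u u≢𝟎 = trans (Σx-AC²-components u)
                        (cong (p *_) (trans (∑-cong (allV n) (λ x → solutionCount-APN apn u x u≢𝟎)) (Σx-const n (+ 2))))

  fourthMoment-component-𝟎 : fourthMoment (component F 𝟎) ≡ p * (p * (p * p))
  fourthMoment-component-𝟎 = trans (fourthMoment≡Σx-AC² (component F 𝟎)) (cong (p *_) (trans
    (∑-cong (allV n) (λ u → cong₂ _*_ (AC-trivial u) (AC-trivial u))) (Σx-const n (p * p))))
    where
    AC-trivial : ∀ u → AC (component F 𝟎) u ≡ p
    AC-trivial u = trans (AC-component 𝟎 u) (trans (∑-cong (allV n) (λ x → cong sgn ⟨𝟎, derivative u x ⟩))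
                                                   (trans (Σx-const n (+ 1)) (ℤₚ.*-identityʳ p)))

  ∑-nonzero-fourthMoment-APN : IsAPN F →
    ∑ (nonzero n) (λ b → fourthMoment (component F b)) ≡ p * (p * (p * (+ 2 * p - + 2)))
  ∑-nonzero-fourthMoment-APN apn = begin
    ∑ (nonzero n) (λ b → fourthMoment (component F b))
      ≡⟨ ∑-nonzero n (λ b → fourthMoment (component F b)) ⟩
    Σx n (λ b → fourthMoment (component F b)) - fourthMoment (component F 𝟎)
      ≡⟨ cong₂ _-_ (Σx-fourthMoment-components apn) fourthMoment-component-𝟎 ⟩
    p * ((p * (p * p) - p * (p * + 2)) + p * (p * (p * + 2))) - p * (p * (p * p))
      ≡⟨ simplify p ⟩
    p * (p * (p * (+ 2 * p - + 2))) ∎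
    where
    open ≡-Reasoning
    simplify : ∀ p → p * ((p * (p * p) - p * (p * + 2)) + p * (p * (p * + 2))) - p * (p * (p * p)) ≡ p * (p * (p * (+ 2 * p - + 2)))
    simplify = solve-∀

-- Plateaued components

2^m*2^m≡4^m : ∀ m → 2 ^ m ℕ.* 2 ^ m ≡ 4 ^ m
2^m*2^m≡4^m zero    = refl
2^m*2^m≡4^m (suc m) = trans (regroup (2 ^ m)) (cong (4 ℕ.*_) (2^m*2^m≡4^m m))
  where
  regroup : ∀ a → (2 ℕ.* a) ℕ.* (2 ℕ.* a) ≡ 4 ℕ.* (a ℕ.* a)
  regroup = ℕ-solve-∀

2^[m*2]≡4^m : ∀ m → 2 ^ (m ℕ.* 2) ≡ 4 ^ m
2^[m*2]≡4^m m = trans (sym (ℕₚ.^-*-assoc 2 m 2))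
                      (trans (cong (2 ^ m ℕ.*_) (ℕₚ.*-identityʳ (2 ^ m))) (2^m*2^m≡4^m m))

^-cancelʳ-≤ : ∀ b {m n} → 1 < b → b ^ m ≤ b ^ n → m ≤ n
^-cancelʳ-≤ b 1<b bᵐ≤bⁿ = ℕₚ.≮⇒≥ (λ n<m → ℕₚ.<⇒≱ (ℕₚ.^-monoʳ-< b 1<b n<m) bᵐ≤bⁿ)

^-cancelʳ-< : ∀ b {m n} → 1 < b → b ^ m < b ^ n → m < n
^-cancelʳ-< b@(suc _) 1<b bᵐ<bⁿ = ℕₚ.≰⇒> (λ n≤m → ℕₚ.<⇒≱ bᵐ<bⁿ (ℕₚ.^-monoʳ-≤ b n≤m))

i*i≡∣i∣*∣i∣ : ∀ z → z * z ≡ + (ℤ.∣ z ∣ ℕ.* ℤ.∣ z ∣)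
i*i≡∣i∣*∣i∣ (+ m)     = sym (ℤₚ.pos-* m m)
i*i≡∣i∣*∣i∣ ℤ.-[1+ m ] = refl

-- For a component, S = Σ_a W(a)⁴ and w = W(0)² are p³(d + 4j) and p·d; ℓ is a lower bound for the
-- excess j, which is additive over components.
record MomentSplit (n : ℕ) (S w ℓ : ℤ) : Set where
  field
    d j : ℤ
    w≡ : w ≡ + (2 ^ n) * d
    S≡ : S ≡ + (2 ^ n) * (+ (2 ^ n) * (+ (2 ^ n) * (d + + 4 * j)))
    ℓ≤j : ℓ ℤ.≤ j

module _ {n t : ℕ} {f : V n → Bool} (plateaued : IsPlateaued t f) where

  private
    h : ℕ
    h = (n ℕ.+ t) ℕ./ 2
    p M : ℤ
    p = + (2 ^ n)
    M = + (4 ^ h)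
    W² : V n → ℤ
    W² a = Walsh f a * Walsh f a

  Walsh²-values : ∀ a → W² a ≡ + 0 ⊎ W² a ≡ M
  Walsh²-values a with plateaued a
  ... | inj₁ ∣W∣≡0  = inj₁ (trans (i*i≡∣i∣*∣i∣ (Walsh f a)) (cong (λ m → + (m ℕ.* m)) ∣W∣≡0))
  ... | inj₂ ∣W∣≡2ʰ = inj₂ (trans (i*i≡∣i∣*∣i∣ (Walsh f a)) (cong +_ (trans (cong (λ m → m ℕ.* m) ∣W∣≡2ʰ) (2^m*2^m≡4^m h))))

  Walsh²≤4ʰ : ∀ a → W² a ℤ.≤ M
  Walsh²≤4ʰ a with Walsh²-values a
  ... | inj₁ W²≡0 = subst (ℤ._≤ M) (sym W²≡0) (ℤ.+≤+ z≤n)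
  ... | inj₂ W²≡M = ℤₚ.≤-reflexive W²≡M

  fourthMoment-plateaued : fourthMoment f ≡ M * (p * p)
  fourthMoment-plateaued = trans (∑-cong (allV n) W⁴≡MW²) (trans (∑-*ˡ (allV n) M W²) (cong (M *_) (parseval f)))
    where
    W⁴≡MW² : ∀ a → W² a * W² a ≡ M * W² a
    W⁴≡MW² a with Walsh²-values a
    ... | inj₁ W²≡0 = trans (cong (W² a *_) W²≡0) (trans (ℤₚ.*-zeroʳ (W² a)) (sym (trans (cong (M *_) W²≡0) (ℤₚ.*-zeroʳ M))))
    ... | inj₂ W²≡M = cong (_* W² a) W²≡M

  2ⁿ≤4ʰ : 2 ^ n ≤ 4 ^ h
  2ⁿ≤4ʰ = ℤₚ.drop‿+≤+ (ℤₚ.*-cancelˡ-≤-pos p M p {{ℤ.positive (ℤ.+<+ (ℕₚ.m^n>0 2 n))}}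
           (subst₂ ℤ._≤_ (parseval f) (Σx-const n M) (∑-mono-≤ (allV n) Walsh²≤4ʰ)))

  2ⁿ<4ʰ : W² 𝟎 ≡ + 0 → 2 ^ n < 4 ^ h
  2ⁿ<4ʰ W²𝟎≡0 = ℤₚ.drop‿+<+ (ℤₚ.*-cancelˡ-<-nonNeg p
    (subst₂ ℤ._<_ (parseval f) (Σx-const n M) (∑-mono-< Walsh²≤4ʰ (∈-allV 𝟎) (subst (ℤ._< M) (sym W²𝟎≡0) 0<M))))
    where
    0<M : + 0 ℤ.< M
    0<M = ℤ.+<+ (ℕₚ.m^n>0 4 h)

  plateaued-split : 2 ∣ n → (ℓ : ℤ) → ℓ ℤ.≤ + 0 ⊎ (ℓ ℤ.≤ + 1 × Walsh f 𝟎 ≡ + 0) →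
                    MomentSplit n (fourthMoment f) (W² 𝟎) ℓ
  plateaued-split (divides k n≡2k) ℓ ℓ-bound = split (Walsh²-values 𝟎)
    where
    open ≡-Reasoning

    2ⁿ≡4ᵏ : 2 ^ n ≡ 4 ^ k
    2ⁿ≡4ᵏ = trans (cong (2 ^_) n≡2k) (2^[m*2]≡4^m k)

    M≡p*4ʳ : ∀ {r} → k ℕ.+ r ≡ h → M ≡ p * + (4 ^ r)
    M≡p*4ʳ {r} k+r≡h = begin
      + (4 ^ h)             ≡⟨ cong (λ e → + (4 ^ e)) k+r≡h ⟨
      + (4 ^ (k ℕ.+ r))     ≡⟨ cong +_ (ℕₚ.^-distribˡ-+-* 4 k r) ⟩
      + (4 ^ k ℕ.* 4 ^ r)   ≡⟨ cong (λ m → + (m ℕ.* 4 ^ r)) 2ⁿ≡4ᵏ ⟨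
      + (2 ^ n ℕ.* 4 ^ r)   ≡⟨ ℤₚ.pos-* (2 ^ n) (4 ^ r) ⟩
      p * + (4 ^ r) ∎

    fourthMoment≡ : ∀ {r} → k ℕ.+ r ≡ h → fourthMoment f ≡ p * (p * (p * + (4 ^ r)))
    fourthMoment≡ {r} k+r≡h =
      trans fourthMoment-plateaued (trans (cong (_* (p * p)) (M≡p*4ʳ k+r≡h)) (regroup p (+ (4 ^ r))))
      where
      regroup : ∀ p e → (p * e) * (p * p) ≡ p * (p * (p * e))
      regroup = solve-∀

    ℓ≤1 : ℓ ℤ.≤ + 0 ⊎ (ℓ ℤ.≤ + 1 × Walsh f 𝟎 ≡ + 0) → ℓ ℤ.≤ + 1
    ℓ≤1 (inj₁ ℓ≤0)       = ℤₚ.≤-trans ℓ≤0 (ℤ.+≤+ z≤n)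
    ℓ≤1 (inj₂ (ℓ≤1 , _)) = ℓ≤1

    split : W² 𝟎 ≡ + 0 ⊎ W² 𝟎 ≡ M → MomentSplit n (fourthMoment f) (W² 𝟎) ℓ
    split (inj₂ W²𝟎≡M) with ℕₚ.m≤n⇒∃[o]m+o≡n (^-cancelʳ-≤ 4 (s≤s (s≤s z≤n)) (subst (_≤ 4 ^ h) 2ⁿ≡4ᵏ 2ⁿ≤4ʰ))
    ... | r , k+r≡h = record
      { d = + (4 ^ r)
      ; j = + 0
      ; w≡ = trans W²𝟎≡M (M≡p*4ʳ k+r≡h)
      ; S≡ = trans (fourthMoment≡ k+r≡h) (cong (λ e → p * (p * (p * e))) (sym (ℤₚ.+-identityʳ (+ (4 ^ r)))))
      ; ℓ≤j = ℓ≤0 ℓ-bound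
      }
      where
      ℓ≤0 : ℓ ℤ.≤ + 0 ⊎ (ℓ ℤ.≤ + 1 × Walsh f 𝟎 ≡ + 0) → ℓ ℤ.≤ + 0
      ℓ≤0 (inj₁ ℓ≤0)       = ℓ≤0
      ℓ≤0 (inj₂ (_ , W𝟎≡0)) =
        ⊥-elim (ℕₚ.<⇒≢ (ℕₚ.m^n>0 4 h) (sym (ℤₚ.+-injective (trans (sym W²𝟎≡M) (cong (λ z → z * z) W𝟎≡0)))))
    split (inj₁ W²𝟎≡0) with ℕₚ.m≤n⇒∃[o]m+o≡n (^-cancelʳ-< 4 (s≤s (s≤s z≤n)) (subst (_< 4 ^ h) 2ⁿ≡4ᵏ (2ⁿ<4ʰ W²𝟎≡0)))
    ... | r , 1+k+r≡h = record
      { d = + 0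
      ; j = + (4 ^ r)
      ; w≡ = trans W²𝟎≡0 (sym (ℤₚ.*-zeroʳ p))
      ; S≡ = trans (fourthMoment≡ (trans (ℕₚ.+-suc k r) 1+k+r≡h))
                   (cong (λ e → p * (p * (p * e))) (trans (ℤₚ.pos-* 4 (4 ^ r)) (sym (ℤₚ.+-identityˡ _))))
      ; ℓ≤j = ℤₚ.≤-trans (ℓ≤1 ℓ-bound) (ℤ.+≤+ (ℕₚ.m^n>0 4 r))
      }

-- Summing over the components

MomentSplit-+ : ∀ {n S w ℓ S′ w′ ℓ′} → MomentSplit n S w ℓ → MomentSplit n S′ w′ ℓ′ →
                MomentSplit n (S + S′) (w + w′) (ℓ + ℓ′)
MomentSplit-+ {n} s s′ = record
  { d = d s + d s′
  ; j = j s + j s′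
  ; w≡ = trans (cong₂ _+_ (w≡ s) (w≡ s′)) (sym (ℤₚ.*-distribˡ-+ p (d s) (d s′)))
  ; S≡ = trans (cong₂ _+_ (S≡ s) (S≡ s′)) (collect p (d s) (j s) (d s′) (j s′))
  ; ℓ≤j = ℤₚ.+-mono-≤ (ℓ≤j s) (ℓ≤j s′)
  }
  where
  open MomentSplit
  p = + (2 ^ n)
  collect : ∀ p d j d′ j′ → p * (p * (p * (d + + 4 * j))) + p * (p * (p * (d′ + + 4 * j′)))
                          ≡ p * (p * (p * ((d + d′) + + 4 * (j + j′))))
  collect = solve-∀

MomentSplit-∑ : ∀ {A : Set} {n} (l : List A) {S w ℓ : A → ℤ} →
                All (λ x → MomentSplit n (S x) (w x) (ℓ x)) l → MomentSplit n (∑ l S) (∑ l w) (∑ l ℓ)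
MomentSplit-∑ {n = n} []      []       = record
  { d = + 0 ; j = + 0 ; w≡ = sym (ℤₚ.*-zeroʳ (+ (2 ^ n))) ; S≡ = sym (vanish (+ (2 ^ n))) ; ℓ≤j = ℤₚ.≤-refl }
  where
  vanish : ∀ p → p * (p * (p * (+ 0 + + 4 * + 0))) ≡ + 0
  vanish = solve-∀
MomentSplit-∑ (x ∷ l) (s ∷ ss) = MomentSplit-+ s (MomentSplit-∑ l ss)

balanced⇒Walsh𝟎≡0 : ∀ n (f : V (suc n) → Bool) → IsBalanced f → Walsh f 𝟎 ≡ + 0
balanced⇒Walsh𝟎≡0 n f balanced = begin
  Walsh f 𝟎
    ≡⟨ ∑-cong (allV (suc n)) sgn≡ ⟩
  Σx (suc n) (λ x → + 2 * zero? x - + 1)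
    ≡⟨ ∑-- (allV (suc n)) (λ x → + 2 * zero? x) (λ _ → + 1) ⟩
  Σx (suc n) (λ x → + 2 * zero? x) - Σx (suc n) (λ _ → + 1)
    ≡⟨ cong₂ _-_ (∑-*ˡ (allV (suc n)) (+ 2) zero?) (Σx-const (suc n) (+ 1)) ⟩
  + 2 * Σx (suc n) zero? - + (2 ^ suc n) * + 1
    ≡⟨ cong₂ (λ z z′ → + 2 * z - z′ * + 1) zeros (ℤₚ.pos-* 2 (2 ^ n)) ⟩
  + 2 * + (2 ^ n) - (+ 2 * + (2 ^ n)) * + 1
    ≡⟨ cancel (+ 2 * + (2 ^ n)) ⟩
  + 0 ∎
  where
  open ≡-Reasoning
  zero? : V (suc n) → ℤ
  zero? x = if does (f x Boolₚ.≟ false) then + 1 else + 0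
  sgn≡ : ∀ x → sgn (f x xor ⟨ 𝟎 , x ⟩) ≡ + 2 * zero? x - + 1
  sgn≡ x rewrite ⟨𝟎, x ⟩ with f x
  ... | false = refl
  ... | true  = refl
  zeros : Σx (suc n) zero? ≡ + (2 ^ n)
  zeros = trans (sym (∑-filter (λ x → f x Boolₚ.≟ false) (allV (suc n)) (λ _ → + 1)))
                (trans (∑-const (filter (λ x → f x Boolₚ.≟ false) (allV (suc n))) (+ 1))
                       (trans (ℤₚ.*-identityʳ _) (cong +_ balanced)))
  cancel : ∀ z → z - z * + 1 ≡ + 0
  cancel = solve-∀

-- For c = suc _ both sides are fromℚᵘ of unnormalised fractions, which are ≃.
*/-cancelˡ : ∀ c .{{_ : ℕ.NonZero c}} (x : ℤ) → (+ c * x) / c ≡ x / 1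
*/-cancelˡ c@(suc _) x = ℚₚ.fromℚᵘ-cong {ℚᵘ.mkℚᵘ (+ c * x) (ℕ.pred c)} {ℚᵘ.mkℚᵘ x 0}
  (ℚᵘ.*≡* (trans (ℤₚ.*-identityʳ (+ c * x)) (ℤₚ.*-comm (+ c) x)))

/1-mono-≤ : ∀ {x y} → x ℤ.≤ y → x / 1 ≤ℚ y / 1
/1-mono-≤ {x} {y} x≤y = ℚₚ.toℚᵘ-cancel-≤
  (ℚᵘₚ.≤-respˡ-≃ (ℚᵘₚ.≃-sym (ℚₚ.toℚᵘ-fromℚᵘ (ℚᵘ.mkℚᵘ x 0)))
    (ℚᵘₚ.≤-respʳ-≃ (ℚᵘₚ.≃-sym (ℚₚ.toℚᵘ-fromℚᵘ (ℚᵘ.mkℚᵘ y 0)))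
      (ℚᵘ.*≤* (ℤₚ.*-monoʳ-≤-nonNeg (+ 1) x≤y))))

record ImbalanceSplit {n} (F : V n → V n) (L : ℤ) : Set where
  field
    d j : ℤ
    Imbalance≡d/1 : Imbalance F ≡ d / 1
    d+4j≡2ⁿ⁺¹-2 : d + + 4 * j ≡ + 2 * + (2 ^ n) - + 2
    L≤j : L ℤ.≤ j

module _ {n : ℕ} (2∣n : 2 ∣ n) {F : V n → V n} (plateaued : IsPlateauedF F) (apn : IsAPN F) where

  private
    p : ℤ
    p = + (2 ^ n)
    instance
      2ⁿ≢0 : ℕ.NonZero (2 ^ n)
      2ⁿ≢0 = ℕₚ.m^n≢0 2 n

  imbalance-split : (ℓ : V n → ℤ) → (∀ b → b ≢ 𝟎 → ℓ b ℤ.≤ + 0 ⊎ (ℓ b ℤ.≤ + 1 × WalshF F b 𝟎 ≡ + 0)) →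
                    ImbalanceSplit F (∑ (nonzero n) ℓ)
  imbalance-split ℓ ℓ-bound = record { d = d ; j = j ; Imbalance≡d/1 = Imbalance≡d/1 ; d+4j≡2ⁿ⁺¹-2 = d+4j≡ ; L≤j = ℓ≤j }
    where
    split : MomentSplit n (∑ (nonzero n) (λ b → fourthMoment (component F b))) (sumSqW F) (∑ (nonzero n) ℓ)
    split = MomentSplit-∑ (nonzero n) (Data.List.Relation.Unary.All.map
      (λ {b} b≢𝟎 → plateaued-split {f = component F b} (proj₂ (plateaued b b≢𝟎)) 2∣n (ℓ b) (ℓ-bound b b≢𝟎))
      (all-filter (λ b → ¬? (b ≟V 𝟎)) (allV n)))
    open MomentSplit split
    Imbalance≡d/1 : Imbalance F ≡ d / 1
    Imbalance≡d/1 = trans (cong (_/ 2 ^ n) w≡) (*/-cancelˡ (2 ^ n) d)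
    d+4j≡ : d + + 4 * j ≡ + 2 * p - + 2
    d+4j≡ = ℤₚ.*-cancelˡ-≡ p _ _ (ℤₚ.*-cancelˡ-≡ p _ _ (ℤₚ.*-cancelˡ-≡ p _ _
              (trans (sym S≡) (∑-nonzero-fourthMoment-APN F apn))))

module _ {n : ℕ} (2∣n : 2 ∣ suc n) {F : V (suc n) → V (suc n)} (plateaued : IsPlateauedF F) (apn : IsAPN F) where

  private
    p q : ℤ
    p = + (2 ^ suc n)
    q = + (2 ^ n)
    isolate : ∀ d j → d ≡ (d + + 4 * j) - + 4 * j
    isolate = solve-∀

  imbalance≡2-mod-4 : ∃[ m ] Imbalance F ≡ (+ 4 * m + + 2) / 1
  imbalance≡2-mod-4 = q - + 1 - j , trans Imbalance≡d/1 (cong (_/ 1) (begin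
    d                                 ≡⟨ isolate d j ⟩
    (d + + 4 * j) - + 4 * j           ≡⟨ cong (_- + 4 * j) d+4j≡2ⁿ⁺¹-2 ⟩
    (+ 2 * p - + 2) - + 4 * j         ≡⟨ cong (λ z → (+ 2 * z - + 2) - + 4 * j) (ℤₚ.pos-* 2 (2 ^ n)) ⟩
    (+ 2 * (+ 2 * q) - + 2) - + 4 * j ≡⟨ regroup q j ⟩
    + 4 * (q - + 1 - j) + + 2         ∎))
    where
    open ImbalanceSplit (imbalance-split 2∣n plateaued apn (λ _ → + 0) (λ _ _ → inj₁ ℤₚ.≤-refl))
    open ≡-Reasoning
    regroup : ∀ q j → (+ 2 * (+ 2 * q) - + 2) - + 4 * j ≡ + 4 * (q - + 1 - j) + + 2
    regroup = solve-∀

  balanced⇒imbalance≤ : (∃[ b ] (b ≢ 𝟎 × IsBalanced (component F b))) → Imbalance F ≤ℚ ((+ (2 ^ (suc n ℕ.+ 1)) - + 6) / 1)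
  balanced⇒imbalance≤ (b₀ , b₀≢𝟎 , balanced) = subst (_≤ℚ _) (sym Imbalance≡d/1) (/1-mono-≤ d≤2p-6)
    where
    δ-bound : ∀ b → b ≢ 𝟎 → δ b b₀ ℤ.≤ + 0 ⊎ (δ b b₀ ℤ.≤ + 1 × WalshF F b 𝟎 ≡ + 0)
    δ-bound b _ with b ≟V b₀
    ... | yes refl = inj₂ (ℤₚ.≤-refl , balanced⇒Walsh𝟎≡0 n (component F b) balanced)
    ... | no _     = inj₁ ℤₚ.≤-refl
    open ImbalanceSplit (imbalance-split 2∣n plateaued apn (λ b → δ b b₀) δ-bound)
    Σδ≡1 : ∑ (nonzero (suc n)) (λ b → δ b b₀) ≡ + 1
    Σδ≡1 = trans (∑-nonzero (suc n) (λ b → δ b b₀)) (cong₂ _-_ (Σx-δ-const (suc n) b₀) (δ-≢ (b₀≢𝟎 ∘ sym)))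
    4≤4j : + 4 ℤ.≤ + 4 * j
    4≤4j = ℤₚ.*-monoˡ-≤-nonNeg (+ 4) (subst (ℤ._≤ j) Σδ≡1 L≤j)
    d≤2p-6 : d ℤ.≤ + (2 ^ (suc n ℕ.+ 1)) - + 6
    d≤2p-6 = begin
      d                           ≡⟨ isolate d j ⟩
      (d + + 4 * j) - + 4 * j     ≡⟨ cong (_- + 4 * j) d+4j≡2ⁿ⁺¹-2 ⟩
      (+ 2 * p - + 2) - + 4 * j   ≤⟨ ℤₚ.+-monoʳ-≤ (+ 2 * p - + 2) (ℤₚ.neg-mono-≤ 4≤4j) ⟩
      (+ 2 * p - + 2) - + 4       ≡⟨ simplify p ⟩
      + 2 * p - + 6               ≡⟨ cong (_- + 6) 2p≡2^[n+2] ⟩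
      + (2 ^ (suc n ℕ.+ 1)) - + 6 ∎
      where
      open ℤₚ.≤-Reasoning
      simplify : ∀ p → (+ 2 * p - + 2) - + 4 ≡ + 2 * p - + 6
      simplify = solve-∀
      2p≡2^[n+2] : + 2 * p ≡ + (2 ^ (suc n ℕ.+ 1))
      2p≡2^[n+2] = trans (sym (ℤₚ.pos-* 2 (2 ^ suc n))) (cong (λ e → + (2 ^ e)) (ℕₚ.+-comm 1 (suc n)))

lemma6p4 : (n : ℕ) → 2 ∣ n → 1 ≤ n → (F : V n → V n) → IsPlateauedF F → IsAPN F →
    (∃[ k ] Imbalance F ≡ (+ 4 Data.Integer.* k Data.Integer.+ + 2) / 1)
    × ((∃[ b ] (b ≢ 𝟎 × IsBalanced (component F b))) →
    Imbalance F ≤ℚ ((+ (2 ^ (n Data.Nat.+ 1)) - + 6) / 1))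
lemma6p4 (suc n) 2∣n _ F plateaued apn = imbalance≡2-mod-4 2∣n plateaued apn , balanced⇒imbalance≤ 2∣n plateaued apn
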